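{- Let $c$ be a positive integer, $k$ a nonnegative integer, $P_k(X):=\prod_{s=0}^{k}(X-s+\sqrt{ -c})\in\mathbb{C}[X]$, and let $\alpha_k\in\mathbb{C}[X]$ be the unique polynomial of degree $\le k$ satisfying $\alpha_kP_k+\overline{\alpha_k}\,\overline{P_k}=1$. Then \[\alpha_k(X)=\frac{1}{2\sqrt{ -c}\left(k-2\sqrt{ -c}\right)^{\underline{k}}}\sum_{\ell=0}^{k}\frac{(-1)^{k+\ell}\binom{k+\ell}{\ell}}{\left(\ell+2\sqrt{ -c}\right)^{\underline{\ell}}}\left(X-\sqrt{ -c}\right)^{\underline{\ell}}.\]
   Context: Here $\sqrt{ -c}=i\sqrt{c}$. For $P\in\mathbb{C}[X]$, $\overline{P}$ is the polynomial obtained by conjugating each coefficient of $P$. Falling factorial powers: $x^{\underline{n}}:=x(x-1)\cdots(x-n+1)$ for $n\in\mathbb{N}$ (with $x^{\underline{0}}=1$), used both for complex numbers $x$ and for the polynomial $X-\sqrt{ -c}$. -}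

module Defs where

open import Data.Nat as ℕ using (ℕ; zero; suc)
open import Data.Nat.Combinatorics using (_C_)
open import Data.Integer using (+_)
open import Data.Rational as ℚ using (ℚ; 0ℚ; 1ℚ)
open import Data.Rational.Properties using (_≟_)
open import Data.List using (List; []; _∷_)
open import Relation.Nullary using (yes; no)
open import Relation.Binary.PropositionalEquality using (_≡_)

-- The field K_c = ℚ(√-c) ⊂ ℂ, with √-c = i√c.
-- An element  a +ω b  stands for the complex number a + b·√-c.
-- (For c ≥ 1 this map K_c → ℂ is an injective ring homomorphism and
-- commutes with complex conjugation.)

infix 4 _+ω_
record K : Set where
  constructor _+ω_
  field
    re : ℚ
    im : ℚ
open K public

ℚ[_] : ℕ → ℚ
ℚ[ n ] = (+ n) ℚ./ 1

0K 1K : K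
0K = 0ℚ +ω 0ℚ
1K = 1ℚ +ω 0ℚ

ω : K
ω = 0ℚ +ω 1ℚ

K[_] : ℕ → K
K[ n ] = ℚ[ n ] +ω 0ℚ

infixl 6 _⊕_ _⊖_
_⊕_ : K → K → K
(a +ω b) ⊕ (a' +ω b') = (a ℚ.+ a') +ω (b ℚ.+ b')

⊝_ : K → K
⊝ (a +ω b) = ℚ.- a +ω ℚ.- b

_⊖_ : K → K → K
x ⊖ y = x ⊕ (⊝ y)

mulK : (c : ℕ) → K → K → K
mulK c (a +ω b) (a' +ω b') =
  (a ℚ.* a' ℚ.- ℚ[ c ] ℚ.* (b ℚ.* b')) +ω (a ℚ.* b' ℚ.+ a' ℚ.* b)

conjK : K → K
conjK (a +ω b) = a +ω ℚ.- b

-- multiplicative inverse; total, with the convention 0⁻¹ = 0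
-- (it is only applied to nonzero elements in the statement)
invK : (c : ℕ) → K → K
invK c (a +ω b) with (a ℚ.* a ℚ.+ ℚ[ c ] ℚ.* (b ℚ.* b)) ≟ 0ℚ
... | yes _  = 0K
... | no d≢0 =
  let instance _ = ℚ.≢-nonZero d≢0
      d⁻¹ = ℚ.1/ (a ℚ.* a ℚ.+ ℚ[ c ] ℚ.* (b ℚ.* b))
  in (a ℚ.* d⁻¹) +ω (ℚ.- b ℚ.* d⁻¹)

fallK : (c : ℕ) → K → ℕ → K
fallK c x zero    = 1K
fallK c x (suc n) = mulK c (fallK c x n) (x ⊖ K[ n ])

signK : ℕ → K
signK zero    = 1K
signK (suc n) = ⊝ signK n

-- Polynomials over K_c: coefficient lists, lowest degree first.

Poly : Set
Poly = List K

coeff : Poly → ℕ → K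
coeff []       _       = 0K
coeff (a ∷ p)  zero    = a
coeff (a ∷ p)  (suc n) = coeff p n

-- equality of polynomials (coefficientwise, trailing zeros irrelevant)
infix 4 _≈P_
_≈P_ : Poly → Poly → Set
p ≈P q = ∀ n → coeff p n ≡ coeff q n

DegLe : Poly → ℕ → Set
DegLe p k = ∀ n → k ℕ.< n → coeff p n ≡ 0K

infixl 6 _⊕P_
_⊕P_ : Poly → Poly → Poly
[]      ⊕P q       = q
(a ∷ p) ⊕P []      = a ∷ p
(a ∷ p) ⊕P (b ∷ q) = (a ⊕ b) ∷ (p ⊕P q)

scaleP : (c : ℕ) → K → Poly → Poly
scaleP c x []      = []
scaleP c x (a ∷ p) = mulK c x a ∷ scaleP c x p

mulP : (c : ℕ) → Poly → Poly → Poly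
mulP c []      q = []
mulP c (a ∷ p) q = scaleP c a q ⊕P (0K ∷ mulP c p q)

conjP : Poly → Poly
conjP []      = []
conjP (a ∷ p) = conjK a ∷ conjP p

oneP : Poly
oneP = 1K ∷ []

X+ : K → Poly
X+ a = a ∷ 1K ∷ []

Pk : (c : ℕ) → ℕ → Poly
Pk c zero    = X+ ω
Pk c (suc k) = mulP c (Pk c k) (X+ (ω ⊖ K[ suc k ]))

fallXω : (c : ℕ) → ℕ → Poly
fallXω c zero    = oneP
fallXω c (suc ℓ) = mulP c (fallXω c ℓ) (X+ (⊝ ω ⊖ K[ ℓ ]))

twoω : K
twoω = ω ⊕ ω

sumTerm : (c k : ℕ) → ℕ → Poly
sumTerm c k ℓ =
  scaleP c (mulK c (mulK c (signK (k ℕ.+ ℓ)) K[ (k ℕ.+ ℓ) C ℓ ])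
                   (invK c (fallK c (K[ ℓ ] ⊕ twoω) ℓ)))
           (fallXω c ℓ)

sumUpTo : (c k : ℕ) → ℕ → Poly
sumUpTo c k zero    = sumTerm c k zero
sumUpTo c k (suc n) = sumUpTo c k n ⊕P sumTerm c k (suc n)

alphaFormula : (c k : ℕ) → Poly
alphaFormula c k =
  scaleP c (invK c (mulK c twoω (fallK c (K[ k ] ⊖ twoω) k))) (sumUpTo c k k)

SolvesBezout : (c k : ℕ) → Poly → Set
SolvesBezout c k α = (mulP c α (Pk c k) ⊕P mulP c (conjP α) (conjP (Pk c k))) ≈P oneP

{-# OPTIONS --safe #-}
module Submission where

-- Write ω = √-c. The factor X − s + ω of P_k vanishes at s − ω, so P_k(s − ω) = 0 and
-- \overline{P_k}(s + ω) = \overline{P_k(s − ω)} = 0 for 0 ≤ s ≤ k. Hence αP_k + ᾱ\overline{P_k} takes the value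
-- α(s + ω)P_k(s + ω) at s + ω and its conjugate at s − ω. For deg α ≤ k this polynomial has degree ≤ 2k + 1, so
-- it equals 1 iff α(s + ω)P_k(s + ω) = 1 at the k + 1 points s + ω; this is an interpolation problem with a
-- unique solution of degree ≤ k. That the formula solves it is the Newton-series identity
--   Σ_ℓ s^{\underline ℓ} (−1)^ℓ C(k+ℓ,ℓ) / (t+ℓ)^{\underline{k+1+ℓ}} = 1 / (t+s)^{\underline{k+1}},
-- proved by induction on s (shifting t to t + 1) and used at t = 2ω, where P_k(s + ω) = (2ω + s)^{\underline{k+1}}.

open import Defs
open import Algebra.Bundles using (CommutativeRing)
open import Algebra.Solver.Ring.AlmostCommutativeRing
  using (fromCommutativeRing; _-Raw-AlmostCommutative⟶_)
open import Algebra.Structures using (IsCommutativeRing)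
open import Data.Empty using (⊥-elim)
open import Data.Integer as ℤ using (ℤ; +_; -[1+_])
import Data.Integer.Properties as ℤP
open import Data.List using (List; []; _∷_; length; applyUpTo; _++_)
open import Data.List.Properties using (length-++; length-applyUpTo)
open import Data.List.Membership.Propositional.Properties using (∈-applyUpTo⁻)
open import Data.List.Relation.Binary.Disjoint.Propositional using (Disjoint)
open import Data.List.Relation.Unary.All as All using (All; []; _∷_)
import Data.List.Relation.Unary.All.Properties as AllP
open import Data.List.Relation.Unary.Unique.Propositional using (Unique; []; _∷_)
import Data.List.Relation.Unary.Unique.Propositional.Properties as UniqueP
open import Data.Maybe using (Maybe; just; nothing)
open import Data.Nat as ℕ using (ℕ; zero; suc; _≤_; _<_; z≤n; s≤s)
open import Data.Nat.Combinatorics using (_C_; nCk+nC[k+1]≡[n+1]C[k+1]; nC1≡n)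
open import Data.Nat.Combinatorics.Specification using (k>n⇒nCk≡0)
open import Data.Nat.Coprimality using (1-coprimeTo) renaming (sym to coprime-sym)
import Data.Nat.Properties as ℕP
import Data.Nat.Solver
open import Data.Product using (_×_; _,_)
import Data.Rational as ℚ
open import Data.Rational using (ℚ; 0ℚ; 1ℚ; mkℚ)
import Data.Rational.Properties as ℚP
import Data.Rational.Solver
open import Data.Sum using (inj₁; inj₂)
open import Relation.Binary.PropositionalEquality
open import Relation.Nullary using (yes; no)

module ℚ-Solver = Data.Rational.Solver.+-*-Solver

p≢0⇒p*q≡0⇒q≡0 : ∀ p q → p ≢ 0ℚ → p ℚ.* q ≡ 0ℚ → q ≡ 0ℚ
p≢0⇒p*q≡0⇒q≡0 p q p≢0 pq≡0 = begin
  q                      ≡⟨ ℚP.*-identityˡ q ⟨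
  1ℚ ℚ.* q               ≡⟨ cong (ℚ._* q) (ℚP.*-inverseˡ p) ⟨
  ℚ.1/ p ℚ.* p ℚ.* q     ≡⟨ ℚP.*-assoc (ℚ.1/ p) p q ⟩
  ℚ.1/ p ℚ.* (p ℚ.* q)   ≡⟨ cong (ℚ.1/ p ℚ.*_) pq≡0 ⟩
  ℚ.1/ p ℚ.* 0ℚ          ≡⟨ ℚP.*-zeroʳ (ℚ.1/ p) ⟩
  0ℚ                     ∎
  where open ≡-Reasoning
        instance _ = ℚ.≢-nonZero p≢0

p*p≡0⇒p≡0 : ∀ p → p ℚ.* p ≡ 0ℚ → p ≡ 0ℚ
p*p≡0⇒p≡0 p pp≡0 with p ℚP.≟ 0ℚ
... | yes p≡0 = p≡0
... | no  p≢0 = ⊥-elim (p≢0 (p≢0⇒p*q≡0⇒q≡0 p p p≢0 pp≡0))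

0≤p*p : ∀ p → 0ℚ ℚ.≤ p ℚ.* p
0≤p*p p = subst (0ℚ ℚ.≤_) ∣p*p∣≡p*p (ℚP.0≤∣p∣ (p ℚ.* p))
  where
  ∣p*p∣≡p*p : ℚ.∣ p ℚ.* p ∣ ≡ p ℚ.* p
  ∣p*p∣≡p*p with ℚP.∣p∣≡p∨∣p∣≡-p p
  ... | inj₁ ∣p∣≡p  = trans (ℚP.∣p*q∣≡∣p∣*∣q∣ p p) (cong₂ ℚ._*_ ∣p∣≡p ∣p∣≡p)
  ... | inj₂ ∣p∣≡-p = trans (ℚP.∣p*q∣≡∣p∣*∣q∣ p p) (trans (cong₂ ℚ._*_ ∣p∣≡-p ∣p∣≡-p)
      (ℚ-Solver.solve 1 (λ p → (:- p) :* (:- p) := p :* p) refl p))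
    where open ℚ-Solver

0≤p⇒0≤q⇒p+q≡0⇒p≡0 : ∀ p q → 0ℚ ℚ.≤ p → 0ℚ ℚ.≤ q → p ℚ.+ q ≡ 0ℚ → p ≡ 0ℚ
0≤p⇒0≤q⇒p+q≡0⇒p≡0 p q 0≤p 0≤q p+q≡0 =
  ℚP.≤-antisym (subst₂ ℚ._≤_ (ℚP.+-identityʳ p) p+q≡0 (ℚP.+-monoʳ-≤ p 0≤q)) 0≤p

fromℤ : ℤ → ℚ
fromℤ i = i ℚ./ 1

fromℤ≡mkℚ : ∀ i → fromℤ i ≡ mkℚ i 0 (coprime-sym (1-coprimeTo ℤ.∣ i ∣))
fromℤ≡mkℚ (+ n)    = ℚP.normalize-coprime (coprime-sym (1-coprimeTo n))
fromℤ≡mkℚ -[1+ n ] = cong ℚ.-_ (ℚP.normalize-coprime (coprime-sym (1-coprimeTo (suc n))))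

fromℤ-homo-+ : ∀ i j → fromℤ (i ℤ.+ j) ≡ fromℤ i ℚ.+ fromℤ j
fromℤ-homo-+ i j rewrite fromℤ≡mkℚ i | fromℤ≡mkℚ j =
  cong (ℚ._/ 1) (sym (cong₂ ℤ._+_ (ℤP.*-identityʳ i) (ℤP.*-identityʳ j)))

fromℤ-homo-* : ∀ i j → fromℤ (i ℤ.* j) ≡ fromℤ i ℚ.* fromℤ j
fromℤ-homo-* i j rewrite fromℤ≡mkℚ i | fromℤ≡mkℚ j = refl

fromℤ-homo‿- : ∀ i → fromℤ (ℤ.- i) ≡ ℚ.- fromℤ i
fromℤ-homo‿- i rewrite fromℤ≡mkℚ i | fromℤ≡mkℚ (ℤ.- i) with i
... | + zero   = refl
... | + suc n  = refl
... | -[1+ n ] = refl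

fromℤK : ℤ → K
fromℤK i = fromℤ i +ω 0ℚ

ℚ[]-injective : ∀ m n → ℚ[ m ] ≡ ℚ[ n ] → m ≡ n
ℚ[]-injective m n eq =
  ℤP.+-injective (cong ℚ.↥_ (trans (sym (fromℤ≡mkℚ (+ m))) (trans eq (fromℤ≡mkℚ (+ n)))))

im-⊕-K[] : ∀ t n → im (t ⊕ K[ n ]) ≡ im t
im-⊕-K[] t n = ℚP.+-identityʳ (im t)

module Coordinates (c : ℕ) where
  open ℚ-Solver

  private
    cℚ = ℚ[ c ]

  infixl 7 _·_
  _·_ : K → K → K
  _·_ = mulK c

  ·-comm : ∀ x y → x · y ≡ y · x
  ·-comm (a +ω b) (a' +ω b') = cong₂ _+ω_
    (solve 5 (λ a b a' b' γ → a :* a' :- γ :* (b :* b') := a' :* a :- γ :* (b' :* b)) refl a b a' b' cℚ)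
    (solve 4 (λ a b a' b' → a :* b' :+ a' :* b := a' :* b :+ a :* b') refl a b a' b')

  ·-assoc : ∀ x y z → (x · y) · z ≡ x · (y · z)
  ·-assoc (a +ω b) (a' +ω b') (a'' +ω b'') = cong₂ _+ω_
    (solve 7 (λ a b a' b' a'' b'' γ →
       (a :* a' :- γ :* (b :* b')) :* a'' :- γ :* ((a :* b' :+ a' :* b) :* b'')
       := a :* (a' :* a'' :- γ :* (b' :* b'')) :- γ :* (b :* (a' :* b'' :+ a'' :* b')))
      refl a b a' b' a'' b'' cℚ)
    (solve 7 (λ a b a' b' a'' b'' γ →
       (a :* a' :- γ :* (b :* b')) :* b'' :+ a'' :* (a :* b' :+ a' :* b)
       := a :* (a' :* b'' :+ a'' :* b') :+ (a' :* a'' :- γ :* (b' :* b'')) :* b)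
      refl a b a' b' a'' b'' cℚ)

  ·-identityˡ : ∀ x → 1K · x ≡ x
  ·-identityˡ (a +ω b) = cong₂ _+ω_
    (solve 3 (λ a b γ → con 1ℚ :* a :- γ :* (con 0ℚ :* b) := a) refl a b cℚ)
    (solve 2 (λ a b → con 1ℚ :* b :+ a :* con 0ℚ := b) refl a b)

  ·-distribˡ-⊕ : ∀ x y z → x · (y ⊕ z) ≡ x · y ⊕ x · z
  ·-distribˡ-⊕ (a +ω b) (a' +ω b') (a'' +ω b'') = cong₂ _+ω_
    (solve 7 (λ a b a' b' a'' b'' γ →
       a :* (a' :+ a'') :- γ :* (b :* (b' :+ b''))
       := (a :* a' :- γ :* (b :* b')) :+ (a :* a'' :- γ :* (b :* b'')))
      refl a b a' b' a'' b'' cℚ)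
    (solve 6 (λ a b a' b' a'' b'' →
       a :* (b' :+ b'') :+ (a' :+ a'') :* b := (a :* b' :+ a' :* b) :+ (a :* b'' :+ a'' :* b))
      refl a b a' b' a'' b'')

  fromℤK-homo-· : ∀ i j → fromℤK (i ℤ.* j) ≡ fromℤK i · fromℤK j
  fromℤK-homo-· i j = cong₂ _+ω_
    (trans (fromℤ-homo-* i j) (solve 2 (λ p γ → p := p :- γ :* con 0ℚ) refl (fromℤ i ℚ.* fromℤ j) cℚ))
    (solve 2 (λ p q → con 0ℚ := p :* con 0ℚ :+ q :* con 0ℚ) refl (fromℤ i) (fromℤ j))

  conjK-homo-⊕ : ∀ x y → conjK (x ⊕ y) ≡ conjK x ⊕ conjK y
  conjK-homo-⊕ (a +ω b) (a' +ω b') = cong (a ℚ.+ a' +ω_) (ℚP.neg-distrib-+ b b')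

  conjK-homo-· : ∀ x y → conjK (x · y) ≡ conjK x · conjK y
  conjK-homo-· (a +ω b) (a' +ω b') = cong₂ _+ω_
    (solve 5 (λ a b a' b' γ → a :* a' :- γ :* (b :* b') := a :* a' :- γ :* ((:- b) :* (:- b')))
      refl a b a' b' cℚ)
    (solve 4 (λ a b a' b' → :- (a :* b' :+ a' :* b) := a :* (:- b') :+ a' :* (:- b))
      refl a b a' b')

  conjK-involutive : ∀ x → conjK (conjK x) ≡ x
  conjK-involutive (a +ω b) = cong (a +ω_) (solve 1 (λ b → :- (:- b) := b) refl b)

  -- For c = 0 the element ω is nilpotent; c ≥ 1 makes the norm a² + c b² definite.
  module _ (1≤c : 1 ≤ c) where

    private
      cℚ≢0 : cℚ ≢ 0ℚ
      cℚ≢0 cℚ≡0 with () ← subst (1 ≤_) (ℚ[]-injective c 0 cℚ≡0) 1≤c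

      0≤cℚ*q*q : ∀ q → 0ℚ ℚ.≤ cℚ ℚ.* (q ℚ.* q)
      0≤cℚ*q*q q = subst (ℚ._≤ cℚ ℚ.* (q ℚ.* q)) (ℚP.*-zeroʳ cℚ)
        (ℚP.*-monoˡ-≤-nonNeg cℚ {{ℚP.normalize-nonNeg c 1}} (0≤p*p q))

    norm≡0⇒≡0K : ∀ a b → a ℚ.* a ℚ.+ cℚ ℚ.* (b ℚ.* b) ≡ 0ℚ → (a +ω b) ≡ 0K
    norm≡0⇒≡0K a b N≡0 = cong₂ _+ω_
      (p*p≡0⇒p≡0 a (0≤p⇒0≤q⇒p+q≡0⇒p≡0 _ _ (0≤p*p a) (0≤cℚ*q*q b) N≡0))
      (p*p≡0⇒p≡0 b (p≢0⇒p*q≡0⇒q≡0 cℚ (b ℚ.* b) cℚ≢0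
        (0≤p⇒0≤q⇒p+q≡0⇒p≡0 _ _ (0≤cℚ*q*q b) (0≤p*p a)
          (trans (ℚP.+-comm (cℚ ℚ.* (b ℚ.* b)) (a ℚ.* a)) N≡0))))

    ·-inverseʳ : ∀ x → x ≢ 0K → x · invK c x ≡ 1K
    ·-inverseʳ (a +ω b) x≢0 with a ℚ.* a ℚ.+ cℚ ℚ.* (b ℚ.* b) ℚP.≟ 0ℚ
    ... | yes N≡0 = ⊥-elim (x≢0 (norm≡0⇒≡0K a b N≡0))
    ... | no  N≢0 = cong₂ _+ω_
        (trans (solve 4 (λ a b γ i → a :* (a :* i) :- γ :* (b :* (:- b :* i))
                                   := (a :* a :+ γ :* (b :* b)) :* i) refl a b cℚ (ℚ.1/ N))
               (ℚP.*-inverseʳ N))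
        (solve 3 (λ a b i → a :* (:- b :* i) :+ a :* i :* b := con 0ℚ) refl a b (ℚ.1/ N))
      where
      N = a ℚ.* a ℚ.+ cℚ ℚ.* (b ℚ.* b)
      instance _ = ℚ.≢-nonZero N≢0

module Ring (c : ℕ) where
  open Coordinates c public using (_·_; conjK-homo-⊕; conjK-homo-·; conjK-involutive)
  open Coordinates c using (·-comm; ·-assoc; ·-identityˡ; ·-distribˡ-⊕; fromℤK-homo-·)

  isCommutativeRing : IsCommutativeRing _≡_ _⊕_ _·_ ⊝_ 0K 1K
  isCommutativeRing = record
    { isRing = record
      { +-isAbelianGroup = record
        { isGroup = record
          { isMonoid = record
            { isSemigroup = record
              { isMagma = record { isEquivalence = isEquivalence ; ∙-cong = cong₂ _⊕_ }
              ; assoc = λ x y z → cong₂ _+ω_ (ℚP.+-assoc (re x) (re y) (re z))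
                                             (ℚP.+-assoc (im x) (im y) (im z)) }
            ; identity = (λ x → cong₂ _+ω_ (ℚP.+-identityˡ (re x)) (ℚP.+-identityˡ (im x)))
                       , (λ x → cong₂ _+ω_ (ℚP.+-identityʳ (re x)) (ℚP.+-identityʳ (im x))) }
          ; inverse = (λ x → cong₂ _+ω_ (ℚP.+-inverseˡ (re x)) (ℚP.+-inverseˡ (im x)))
                    , (λ x → cong₂ _+ω_ (ℚP.+-inverseʳ (re x)) (ℚP.+-inverseʳ (im x)))
          ; ⁻¹-cong = cong ⊝_ }
        ; comm = λ x y → cong₂ _+ω_ (ℚP.+-comm (re x) (re y)) (ℚP.+-comm (im x) (im y)) }
      ; *-cong = cong₂ _·_
      ; *-assoc = ·-assoc
      ; *-identity = ·-identityˡ , λ x → trans (·-comm x 1K) (·-identityˡ x)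
      ; distrib = ·-distribˡ-⊕
                , λ x y z → trans (·-comm (y ⊕ z) x)
                    (trans (·-distribˡ-⊕ x y z) (cong₂ _⊕_ (·-comm x y) (·-comm x z))) }
    ; *-comm = ·-comm }

  commutativeRing : CommutativeRing _ _
  commutativeRing = record { isCommutativeRing = isCommutativeRing }

  -- The solver takes integer coefficients: con (+ n) denotes K[ n ], and coefficient arithmetic computes in ℤ.
  fromℤ-morphism : ℤ.+-*-rawRing -Raw-AlmostCommutative⟶ fromCommutativeRing commutativeRing
  fromℤ-morphism = record
    { ⟦_⟧    = fromℤK
    ; +-homo = λ i j → cong (_+ω 0ℚ) (fromℤ-homo-+ i j)
    ; *-homo = fromℤK-homo-·
    ; -‿homo = λ i → cong (_+ω 0ℚ) (fromℤ-homo‿- i)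
    ; 0-homo = refl
    ; 1-homo = refl }

  private
    fromℤ-≟ : ∀ i j → Maybe (fromℤK i ≡ fromℤK j)
    fromℤ-≟ i j with i ℤ.≟ j
    ... | yes refl = just refl
    ... | no _     = nothing

  open import Algebra.Solver.Ring ℤ.+-*-rawRing (fromCommutativeRing commutativeRing) fromℤ-morphism fromℤ-≟
    public using (solve; _:=_; _:+_; _:*_; :-_; _:-_; con)

  K[]-homo-+ : ∀ m n → K[ m ℕ.+ n ] ≡ K[ m ] ⊕ K[ n ]
  K[]-homo-+ m n = _-Raw-AlmostCommutative⟶_.+-homo fromℤ-morphism (+ m) (+ n)

  K[]-homo-* : ∀ m n → K[ m ℕ.* n ] ≡ K[ m ] · K[ n ]
  K[]-homo-* m n = trans (cong fromℤK (ℤP.pos-* m n))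
                         (_-Raw-AlmostCommutative⟶_.*-homo fromℤ-morphism (+ m) (+ n))

  x⊖y≡0K⇒x≡y : ∀ x y → x ⊖ y ≡ 0K → x ≡ y
  x⊖y≡0K⇒x≡y x y x-y≡0 = begin
    x             ≡⟨ solve 2 (λ x y → x := (x :- y) :+ y) refl x y ⟩
    (x ⊖ y) ⊕ y   ≡⟨ cong (_⊕ y) x-y≡0 ⟩
    0K ⊕ y        ≡⟨ solve 1 (λ y → con (+ 0) :+ y := y) refl y ⟩
    y             ∎
    where open ≡-Reasoning

  ⊕-K[]-+ : ∀ t m n → t ⊕ K[ m ] ⊕ K[ n ] ≡ t ⊕ K[ m ℕ.+ n ]
  ⊕-K[]-+ t m n = trans (solve 3 (λ t a b → t :+ a :+ b := t :+ (a :+ b)) refl t K[ m ] K[ n ])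
                        (cong (t ⊕_) (sym (K[]-homo-+ m n)))

module Field (c : ℕ) (1≤c : 1 ≤ c) where
  open Ring c

  ·-inverseʳ : ∀ x → x ≢ 0K → x · invK c x ≡ 1K
  ·-inverseʳ = Coordinates.·-inverseʳ c 1≤c

  ·-inverseˡ : ∀ x → x ≢ 0K → invK c x · x ≡ 1K
  ·-inverseˡ x x≢0 = trans (solve 2 (λ x y → y :* x := x :* y) refl x (invK c x)) (·-inverseʳ x x≢0)

  1K≢0K : 1K ≢ 0K
  1K≢0K eq = ℚP.1≢0 (cong re eq)

  im≢0⇒≢0K : ∀ x → im x ≢ 0ℚ → x ≢ 0K
  im≢0⇒≢0K x im≢0 x≡0 = im≢0 (cong im x≡0)

  x≢0⇒x·y≡0⇒y≡0 : ∀ x y → x ≢ 0K → x · y ≡ 0K → y ≡ 0K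
  x≢0⇒x·y≡0⇒y≡0 x y x≢0 xy≡0 = begin
    y                    ≡⟨ solve 2 (λ x y → y := con (+ 1) :* y) refl x y ⟩
    1K · y               ≡⟨ cong (_· y) (·-inverseˡ x x≢0) ⟨
    invK c x · x · y     ≡⟨ solve 3 (λ x y x⁻¹ → x⁻¹ :* x :* y := x⁻¹ :* (x :* y)) refl x y (invK c x) ⟩
    invK c x · (x · y)   ≡⟨ cong (invK c x ·_) xy≡0 ⟩
    invK c x · 0K        ≡⟨ solve 1 (λ x⁻¹ → x⁻¹ :* con (+ 0) := con (+ 0)) refl (invK c x) ⟩
    0K                   ∎
    where open ≡-Reasoning

  x≢0⇒y≢0⇒x·y≢0 : ∀ x y → x ≢ 0K → y ≢ 0K → x · y ≢ 0K
  x≢0⇒y≢0⇒x·y≢0 x y x≢0 y≢0 xy≡0 = y≢0 (x≢0⇒x·y≡0⇒y≡0 x y x≢0 xy≡0)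

  invK-unique : ∀ x y → x · y ≡ 1K → invK c x ≡ y
  invK-unique x y xy≡1 = begin
    invK c x             ≡⟨ solve 1 (λ x⁻¹ → x⁻¹ := x⁻¹ :* con (+ 1)) refl (invK c x) ⟩
    invK c x · 1K        ≡⟨ cong (invK c x ·_) xy≡1 ⟨
    invK c x · (x · y)   ≡⟨ solve 3 (λ x y x⁻¹ → x⁻¹ :* (x :* y) := x⁻¹ :* x :* y) refl x y (invK c x) ⟩
    invK c x · x · y     ≡⟨ cong (_· y) (·-inverseˡ x x≢0) ⟩
    1K · y               ≡⟨ solve 1 (λ y → con (+ 1) :* y := y) refl y ⟩
    y                    ∎
    where
    open ≡-Reasoning
    x≢0 : x ≢ 0K
    x≢0 x≡0 = 1K≢0K (begin
      1K      ≡⟨ xy≡1 ⟨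
      x · y   ≡⟨ cong (_· y) x≡0 ⟩
      0K · y  ≡⟨ solve 1 (λ y → con (+ 0) :* y := con (+ 0)) refl y ⟩
      0K      ∎)

  invK-factor : ∀ x y z → x · y ≡ z → z ≢ 0K → invK c x ≡ y · invK c z
  invK-factor x y z xy≡z z≢0 = invK-unique x (y · invK c z) (begin
    x · (y · invK c z)   ≡⟨ solve 3 (λ x y z⁻¹ → x :* (y :* z⁻¹) := x :* y :* z⁻¹) refl x y (invK c z) ⟩
    x · y · invK c z     ≡⟨ cong (_· invK c z) xy≡z ⟩
    z · invK c z         ≡⟨ ·-inverseʳ z z≢0 ⟩
    1K                   ∎)
    where open ≡-Reasoning

  fallK-≢0 : ∀ y n → im y ≢ 0ℚ → fallK c y n ≢ 0K
  fallK-≢0 y zero    im≢0 = 1K≢0K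
  fallK-≢0 y (suc n) im≢0 = x≢0⇒y≢0⇒x·y≢0 (fallK c y n) (y ⊖ K[ n ]) (fallK-≢0 y n im≢0)
    (im≢0⇒≢0K (y ⊖ K[ n ]) (λ im≡0 → im≢0 (trans (sym (ℚP.+-identityʳ (im y))) im≡0)))

DegLt : Poly → ℕ → Set
DegLt p d = ∀ n → d ≤ n → coeff p n ≡ 0K

DegLt-weaken : ∀ p {d d'} → d ≤ d' → DegLt p d → DegLt p d'
DegLt-weaken p d≤d' deg n d'≤n = deg n (ℕP.≤-trans d≤d' d'≤n)

DegLt-length : ∀ p → DegLt p (length p)
DegLt-length []      n       _         = refl
DegLt-length (a ∷ p) (suc n) (s≤s le) = DegLt-length p n le

coeff-conjP : ∀ p n → coeff (conjP p) n ≡ conjK (coeff p n)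
coeff-conjP []      n       = refl
coeff-conjP (a ∷ p) zero    = refl
coeff-conjP (a ∷ p) (suc n) = coeff-conjP p n

DegLt-conjP : ∀ p {d} → DegLt p d → DegLt (conjP p) d
DegLt-conjP p deg n le = trans (coeff-conjP p n) (cong conjK (deg n le))

module Polynomials (c : ℕ) where
  open Ring c

  evalP : Poly → K → K
  evalP []      x = 0K
  evalP (a ∷ p) x = a ⊕ x · evalP p x

  coeff-⊕P : ∀ p q n → coeff (p ⊕P q) n ≡ coeff p n ⊕ coeff q n
  coeff-⊕P []      q       n       = solve 1 (λ y → y := con (+ 0) :+ y) refl (coeff q n)
  coeff-⊕P (a ∷ p) []      n       = solve 1 (λ y → y := y :+ con (+ 0)) refl (coeff (a ∷ p) n)
  coeff-⊕P (a ∷ p) (b ∷ q) zero    = refl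
  coeff-⊕P (a ∷ p) (b ∷ q) (suc n) = coeff-⊕P p q n

  coeff-scaleP : ∀ a p n → coeff (scaleP c a p) n ≡ a · coeff p n
  coeff-scaleP a []      n       = solve 1 (λ a → con (+ 0) := a :* con (+ 0)) refl a
  coeff-scaleP a (b ∷ p) zero    = refl
  coeff-scaleP a (b ∷ p) (suc n) = coeff-scaleP a p n

  evalP-⊕P : ∀ p q x → evalP (p ⊕P q) x ≡ evalP p x ⊕ evalP q x
  evalP-⊕P []      q       x = solve 1 (λ y → y := con (+ 0) :+ y) refl (evalP q x)
  evalP-⊕P (a ∷ p) []      x = solve 1 (λ y → y := y :+ con (+ 0)) refl (evalP (a ∷ p) x)
  evalP-⊕P (a ∷ p) (b ∷ q) x rewrite evalP-⊕P p q x =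
    solve 5 (λ a b x u v → a :+ b :+ x :* (u :+ v) := a :+ x :* u :+ (b :+ x :* v))
      refl a b x (evalP p x) (evalP q x)

  evalP-scaleP : ∀ a p x → evalP (scaleP c a p) x ≡ a · evalP p x
  evalP-scaleP a []      x = solve 1 (λ a → con (+ 0) := a :* con (+ 0)) refl a
  evalP-scaleP a (b ∷ p) x rewrite evalP-scaleP a p x =
    solve 4 (λ a b x u → a :* b :+ x :* (a :* u) := a :* (b :+ x :* u)) refl a b x (evalP p x)

  evalP-mulP : ∀ p q x → evalP (mulP c p q) x ≡ evalP p x · evalP q x
  evalP-mulP []      q x = solve 1 (λ v → con (+ 0) := con (+ 0) :* v) refl (evalP q x)
  evalP-mulP (a ∷ p) q x
    rewrite evalP-⊕P (scaleP c a q) (0K ∷ mulP c p q) x | evalP-scaleP a q x | evalP-mulP p q x =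
    solve 4 (λ a x u v → a :* v :+ (con (+ 0) :+ x :* (u :* v)) := (a :+ x :* u) :* v)
      refl a x (evalP p x) (evalP q x)

  evalP-conjP : ∀ p x → evalP (conjP p) x ≡ conjK (evalP p (conjK x))
  evalP-conjP []      x = refl
  evalP-conjP (a ∷ p) x = begin
    conjK a ⊕ x · evalP (conjP p) x                 ≡⟨ cong (λ y → conjK a ⊕ y · evalP (conjP p) x) (conjK-involutive x) ⟨
    conjK a ⊕ conjK (conjK x) · evalP (conjP p) x   ≡⟨ cong (λ y → conjK a ⊕ conjK (conjK x) · y) (evalP-conjP p x) ⟩
    conjK a ⊕ conjK (conjK x) · conjK (evalP p (conjK x))
      ≡⟨ cong (conjK a ⊕_) (conjK-homo-· (conjK x) (evalP p (conjK x))) ⟨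
    conjK a ⊕ conjK (conjK x · evalP p (conjK x))    ≡⟨ conjK-homo-⊕ a (conjK x · evalP p (conjK x)) ⟨
    conjK (a ⊕ conjK x · evalP p (conjK x))          ∎
    where open ≡-Reasoning

  evalP-X+ : ∀ a x → evalP (X+ a) x ≡ a ⊕ x
  evalP-X+ a x = solve 2 (λ a x → a :+ x :* (con (+ 1) :+ x :* con (+ 0)) := a :+ x) refl a x

  evalP-mulP-X+ : ∀ p a x → evalP (mulP c p (X+ a)) x ≡ evalP p x · (a ⊕ x)
  evalP-mulP-X+ p a x = trans (evalP-mulP p (X+ a) x) (cong (evalP p x ·_) (evalP-X+ a x))

  evalP-≈P[] : ∀ p x → p ≈P [] → evalP p x ≡ 0K
  evalP-≈P[] []      x p≈0 = refl
  evalP-≈P[] (a ∷ p) x p≈0 rewrite p≈0 0 | evalP-≈P[] p x (λ n → p≈0 (suc n)) =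
    solve 1 (λ x → con (+ 0) :+ x :* con (+ 0) := con (+ 0)) refl x

  evalP-≈P : ∀ p q x → p ≈P q → evalP p x ≡ evalP q x
  evalP-≈P []      q       x p≈q = sym (evalP-≈P[] q x (λ n → sym (p≈q n)))
  evalP-≈P (a ∷ p) []      x p≈q = evalP-≈P[] (a ∷ p) x p≈q
  evalP-≈P (a ∷ p) (b ∷ q) x p≈q =
    cong₂ (λ u v → u ⊕ x · v) (p≈q 0) (evalP-≈P p q x (λ n → p≈q (suc n)))

  DegLt-⊕P : ∀ p q {d} → DegLt p d → DegLt q d → DegLt (p ⊕P q) d
  DegLt-⊕P p q degp degq n le rewrite coeff-⊕P p q n | degp n le | degq n le =
    solve 0 (con (+ 0) :+ con (+ 0) := con (+ 0)) refl

  DegLt-scaleP : ∀ a p {d} → DegLt p d → DegLt (scaleP c a p) d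
  DegLt-scaleP a p deg n le rewrite coeff-scaleP a p n | deg n le =
    solve 1 (λ a → a :* con (+ 0) := con (+ 0)) refl a

  mulP-≈[]ˡ : ∀ p q → p ≈P [] → mulP c p q ≈P []
  mulP-≈[]ˡ []      q p≈0 n = refl
  mulP-≈[]ˡ (a ∷ p) q p≈0 n
    rewrite coeff-⊕P (scaleP c a q) (0K ∷ mulP c p q) n | coeff-scaleP a q n | p≈0 0 = go n
    where
    go : ∀ n → 0K · coeff q n ⊕ coeff (0K ∷ mulP c p q) n ≡ 0K
    go zero    = solve 1 (λ y → con (+ 0) :* y :+ con (+ 0) := con (+ 0)) refl (coeff q 0)
    go (suc n) rewrite mulP-≈[]ˡ p q (λ m → p≈0 (suc m)) n =
      solve 1 (λ y → con (+ 0) :* y :+ con (+ 0) := con (+ 0)) refl (coeff q (suc n))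

  DegLt-mulP : ∀ p q {d e} → DegLt p d → DegLt q (suc e) → DegLt (mulP c p q) (d ℕ.+ e)
  DegLt-mulP []      q             degp degq n       le       = refl
  DegLt-mulP (a ∷ p) q {zero}      degp degq n       le       = mulP-≈[]ˡ (a ∷ p) q (λ m → degp m z≤n) n
  DegLt-mulP (a ∷ p) q {suc d} {e} degp degq (suc n) (s≤s le)
    rewrite coeff-⊕P (scaleP c a q) (0K ∷ mulP c p q) (suc n) | coeff-scaleP a q (suc n)
          | degq (suc n) (s≤s (ℕP.≤-trans (ℕP.m≤n+m e d) le))
          | DegLt-mulP p q {d} (λ m le' → degp (suc m) (s≤s le')) degq n le =
    solve 1 (λ a → a :* con (+ 0) :+ con (+ 0) := con (+ 0)) refl a

  DegLt-mulP-X+ : ∀ p a {d} → DegLt p d → DegLt (mulP c p (X+ a)) (suc d)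
  DegLt-mulP-X+ p a {d} deg = DegLt-weaken (mulP c p (X+ a)) (ℕP.≤-reflexive (ℕP.+-comm d 1))
    (DegLt-mulP p (X+ a) deg (DegLt-length (X+ a)))

  quotientP : Poly → K → Poly
  quotientP []       a = []
  quotientP (p₀ ∷ p) a = evalP p a ∷ quotientP p a

  evalP-quotientP : ∀ p a x → evalP p x ≡ (x ⊖ a) · evalP (quotientP p a) x ⊕ evalP p a
  evalP-quotientP []       a x = solve 2 (λ a x → con (+ 0) := (x :- a) :* con (+ 0) :+ con (+ 0)) refl a x
  evalP-quotientP (p₀ ∷ p) a x rewrite evalP-quotientP p a x =
    solve 5 (λ p₀ a x q r → p₀ :+ x :* ((x :- a) :* q :+ r) := (x :- a) :* (r :+ x :* q) :+ (p₀ :+ a :* r))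
      refl p₀ a x (evalP (quotientP p a) x) (evalP p a)

  DegLt-quotientP : ∀ p a n → DegLt p (suc n) → DegLt (quotientP p a) n
  DegLt-quotientP []       a n       deg m       _        = refl
  DegLt-quotientP (p₀ ∷ p) a zero    deg zero    _        = evalP-≈P[] p a (λ m → deg (suc m) (s≤s z≤n))
  DegLt-quotientP (p₀ ∷ p) a zero    deg (suc m) _        =
    DegLt-quotientP p a zero (λ m' _ → deg (suc m') (s≤s z≤n)) m z≤n
  DegLt-quotientP (p₀ ∷ p) a (suc n) deg (suc m) (s≤s le) =
    DegLt-quotientP p a n (λ m' le' → deg (suc m') (s≤s le')) m le

  quotientP-≈[] : ∀ p a → quotientP p a ≈P [] → evalP p a ≡ 0K → p ≈P []
  quotientP-≈[] []       a q≈0 pa≡0 m       = refl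
  quotientP-≈[] (p₀ ∷ p) a q≈0 pa≡0 zero    = begin
    p₀                   ≡⟨ solve 2 (λ p₀ a → p₀ := p₀ :+ a :* con (+ 0)) refl p₀ a ⟩
    p₀ ⊕ a · 0K          ≡⟨ cong (λ y → p₀ ⊕ a · y) (q≈0 0) ⟨
    p₀ ⊕ a · evalP p a   ≡⟨ pa≡0 ⟩
    0K                   ∎
    where open ≡-Reasoning
  quotientP-≈[] (p₀ ∷ p) a q≈0 pa≡0 (suc m) = quotientP-≈[] p a (λ n → q≈0 (suc n)) (q≈0 0) m

  infixl 6 _⊖P_
  _⊖P_ : Poly → Poly → Poly
  p ⊖P q = p ⊕P scaleP c (⊝ 1K) q

  coeff-⊖P : ∀ p q n → coeff (p ⊖P q) n ≡ coeff p n ⊖ coeff q n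
  coeff-⊖P p q n = trans (coeff-⊕P p (scaleP c (⊝ 1K) q) n)
    (cong (coeff p n ⊕_) (trans (coeff-scaleP (⊝ 1K) q n) (solve 1 (λ a → (:- con (+ 1)) :* a := :- a) refl (coeff q n))))

  evalP-⊖P : ∀ p q x → evalP (p ⊖P q) x ≡ evalP p x ⊖ evalP q x
  evalP-⊖P p q x = trans (evalP-⊕P p (scaleP c (⊝ 1K) q) x)
    (cong (evalP p x ⊕_) (trans (evalP-scaleP (⊝ 1K) q x) (solve 1 (λ a → (:- con (+ 1)) :* a := :- a) refl (evalP q x))))

  DegLt-⊖P : ∀ p q {d} → DegLt p d → DegLt q d → DegLt (p ⊖P q) d
  DegLt-⊖P p q degp degq = DegLt-⊕P p (scaleP c (⊝ 1K) q) degp (DegLt-scaleP (⊝ 1K) q degq)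

  ⊖P≈[]⇒≈P : ∀ p q → p ⊖P q ≈P [] → p ≈P q
  ⊖P≈[]⇒≈P p q p-q≈0 n = x⊖y≡0K⇒x≡y (coeff p n) (coeff q n) (trans (sym (coeff-⊖P p q n)) (p-q≈0 n))

module Roots (c : ℕ) (1≤c : 1 ≤ c) where
  open Ring c
  open Field c 1≤c
  open Polynomials c

  roots⇒≈[] : ∀ p xs → Unique xs → All (λ x → evalP p x ≡ 0K) xs → DegLt p (length xs) → p ≈P []
  roots⇒≈[] p []       _               _              deg n = deg n z≤n
  roots⇒≈[] p (a ∷ xs) (a≢xs ∷ unique) (pa≡0 ∷ roots) deg =
    quotientP-≈[] p a (roots⇒≈[] (quotientP p a) xs unique (All.zipWith root-of-quotient (a≢xs , roots))
                                 (DegLt-quotientP p a (length xs) deg))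
                      pa≡0
    where
    root-of-quotient : ∀ {x} → a ≢ x × evalP p x ≡ 0K → evalP (quotientP p a) x ≡ 0K
    root-of-quotient {x} (a≢x , px≡0) =
      x≢0⇒x·y≡0⇒y≡0 (x ⊖ a) q (λ x-a≡0 → a≢x (sym (x⊖y≡0K⇒x≡y x a x-a≡0)))
        (begin
          (x ⊖ a) · q               ≡⟨ solve 1 (λ y → y := y :+ con (+ 0)) refl ((x ⊖ a) · q) ⟩
          (x ⊖ a) · q ⊕ 0K          ≡⟨ cong ((x ⊖ a) · q ⊕_) pa≡0 ⟨
          (x ⊖ a) · q ⊕ evalP p a   ≡⟨ evalP-quotientP p a x ⟨
          evalP p x                 ≡⟨ px≡0 ⟩
          0K                        ∎)
      where
      open ≡-Reasoning
      q = evalP (quotientP p a) x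

  agree⇒≈P : ∀ p q xs → Unique xs → All (λ x → evalP p x ≡ evalP q x) xs →
             DegLt p (length xs) → DegLt q (length xs) → p ≈P q
  agree⇒≈P p q xs unique agree degp degq = ⊖P≈[]⇒≈P p q
    (roots⇒≈[] (p ⊖P q) xs unique (All.map root-of-difference agree) (DegLt-⊖P p q degp degq))
    where
    root-of-difference : ∀ {x} → evalP p x ≡ evalP q x → evalP (p ⊖P q) x ≡ 0K
    root-of-difference {x} px≡qx = trans (evalP-⊖P p q x)
      (trans (cong (_⊖ evalP q x) px≡qx) (solve 1 (λ y → y :- y := con (+ 0)) refl (evalP q x)))

module FallingFactorials (c : ℕ) where
  open Ring c
  open ≡-Reasoning

  fallK-suc : ∀ y n → fallK c y (suc n) ≡ y · fallK c (y ⊖ K[ 1 ]) n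
  fallK-suc y zero    = solve 1 (λ y → con (+ 1) :* (y :- con (+ 0)) := y :* con (+ 1)) refl y
  fallK-suc y (suc n) = begin
    fallK c y (suc n) · (y ⊖ K[ 1 ℕ.+ n ])
      ≡⟨ cong₂ (λ u v → u · (y ⊖ v)) (fallK-suc y n) (K[]-homo-+ 1 n) ⟩
    y · fallK c (y ⊖ K[ 1 ]) n · (y ⊖ (K[ 1 ] ⊕ K[ n ]))
      ≡⟨ solve 3 (λ y F n → y :* F :* (y :- (con (+ 1) :+ n)) := y :* (F :* ((y :- con (+ 1)) :- n)))
           refl y (fallK c (y ⊖ K[ 1 ]) n) K[ n ] ⟩
    y · (fallK c (y ⊖ K[ 1 ]) n · ((y ⊖ K[ 1 ]) ⊖ K[ n ])) ∎

  fallK-+ : ∀ m n y → fallK c y (m ℕ.+ n) ≡ fallK c y m · fallK c (y ⊖ K[ m ]) n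
  fallK-+ zero    n y = begin
    fallK c y n                  ≡⟨ cong (λ z → fallK c z n) (solve 1 (λ y → y := y :- con (+ 0)) refl y) ⟩
    fallK c (y ⊖ K[ 0 ]) n       ≡⟨ solve 1 (λ F → F := con (+ 1) :* F) refl (fallK c (y ⊖ K[ 0 ]) n) ⟩
    1K · fallK c (y ⊖ K[ 0 ]) n  ∎
  fallK-+ (suc m) n y = begin
    fallK c y (suc (m ℕ.+ n))                                  ≡⟨ fallK-suc y (m ℕ.+ n) ⟩
    y · fallK c (y ⊖ K[ 1 ]) (m ℕ.+ n)                         ≡⟨ cong (y ·_) (fallK-+ m n (y ⊖ K[ 1 ])) ⟩
    y · (fallK c (y ⊖ K[ 1 ]) m · fallK c (y ⊖ K[ 1 ] ⊖ K[ m ]) n)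
      ≡⟨ cong (λ z → y · (fallK c (y ⊖ K[ 1 ]) m · fallK c z n)) y-1-m≡y-[1+m] ⟩
    y · (fallK c (y ⊖ K[ 1 ]) m · fallK c (y ⊖ K[ suc m ]) n)
      ≡⟨ solve 3 (λ y F G → y :* (F :* G) := y :* F :* G) refl y (fallK c (y ⊖ K[ 1 ]) m) (fallK c (y ⊖ K[ suc m ]) n) ⟩
    y · fallK c (y ⊖ K[ 1 ]) m · fallK c (y ⊖ K[ suc m ]) n    ≡⟨ cong (_· fallK c (y ⊖ K[ suc m ]) n) (fallK-suc y m) ⟨
    fallK c y (suc m) · fallK c (y ⊖ K[ suc m ]) n             ∎
    where
    y-1-m≡y-[1+m] : y ⊖ K[ 1 ] ⊖ K[ m ] ≡ y ⊖ K[ suc m ]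
    y-1-m≡y-[1+m] = trans (solve 2 (λ y m → y :- con (+ 1) :- m := y :- (con (+ 1) :+ m)) refl y K[ m ])
                          (sym (cong (y ⊖_) (K[]-homo-+ 1 m)))

  signK-+ : ∀ m n → signK (m ℕ.+ n) ≡ signK m · signK n
  signK-+ zero    n = solve 1 (λ σ → σ := con (+ 1) :* σ) refl (signK n)
  signK-+ (suc m) n rewrite signK-+ m n = solve 2 (λ σ τ → :- (σ :* τ) := (:- σ) :* τ) refl (signK m) (signK n)

  signK-·-signK : ∀ n → signK n · signK n ≡ 1K
  signK-·-signK zero    = solve 0 (con (+ 1) :* con (+ 1) := con (+ 1)) refl
  signK-·-signK (suc n) = trans (solve 1 (λ σ → (:- σ) :* (:- σ) := σ :* σ) refl (signK n)) (signK-·-signK n)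

  fallK-reflect : ∀ n y → signK n · fallK c (K[ n ] ⊖ y) n ≡ fallK c (y ⊖ K[ 1 ]) n
  fallK-reflect zero    y = solve 0 (con (+ 1) :* con (+ 1) := con (+ 1)) refl
  fallK-reflect (suc n) y = begin
    ⊝ signK n · fallK c (K[ 1 ℕ.+ n ] ⊖ y) (suc n)
      ≡⟨ cong (λ z → ⊝ signK n · fallK c (z ⊖ y) (suc n)) (K[]-homo-+ 1 n) ⟩
    ⊝ signK n · fallK c (K[ 1 ] ⊕ K[ n ] ⊖ y) (suc n)
      ≡⟨ cong (⊝ signK n ·_) (fallK-suc (K[ 1 ] ⊕ K[ n ] ⊖ y) n) ⟩
    ⊝ signK n · ((K[ 1 ] ⊕ K[ n ] ⊖ y) · fallK c (K[ 1 ] ⊕ K[ n ] ⊖ y ⊖ K[ 1 ]) n)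
      ≡⟨ cong (λ z → ⊝ signK n · ((K[ 1 ] ⊕ K[ n ] ⊖ y) · fallK c z n))
              (solve 2 (λ n y → con (+ 1) :+ n :- y :- con (+ 1) := n :- y) refl K[ n ] y) ⟩
    ⊝ signK n · ((K[ 1 ] ⊕ K[ n ] ⊖ y) · fallK c (K[ n ] ⊖ y) n)
      ≡⟨ solve 4 (λ σ n y F → (:- σ) :* ((con (+ 1) :+ n :- y) :* F) := (σ :* F) :* ((y :- con (+ 1)) :- n))
           refl (signK n) K[ n ] y (fallK c (K[ n ] ⊖ y) n) ⟩
    signK n · fallK c (K[ n ] ⊖ y) n · ((y ⊖ K[ 1 ]) ⊖ K[ n ])
      ≡⟨ cong (_· ((y ⊖ K[ 1 ]) ⊖ K[ n ])) (fallK-reflect n y) ⟩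
    fallK c (y ⊖ K[ 1 ]) n · ((y ⊖ K[ 1 ]) ⊖ K[ n ]) ∎

  fallK-K[]-vanishes : ∀ s n → s < n → fallK c K[ s ] n ≡ 0K
  fallK-K[]-vanishes s (suc n) (s≤s s≤n) with ℕP.m≤n⇒m<n∨m≡n s≤n
  ... | inj₁ s<n  rewrite fallK-K[]-vanishes s n s<n =
    solve 1 (λ y → con (+ 0) :* y := con (+ 0)) refl (K[ s ] ⊖ K[ n ])
  ... | inj₂ refl = solve 2 (λ F s → F :* (s :- s) := con (+ 0)) refl (fallK c K[ s ] s) K[ s ]

  fallK-K[]-suc : ∀ s n → fallK c K[ suc s ] (suc n) ≡ fallK c K[ s ] (suc n) ⊕ K[ suc n ] · fallK c K[ s ] n
  fallK-K[]-suc s n = begin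
    fallK c K[ 1 ℕ.+ s ] (suc n)               ≡⟨ fallK-suc K[ 1 ℕ.+ s ] n ⟩
    K[ 1 ℕ.+ s ] · fallK c (K[ 1 ℕ.+ s ] ⊖ K[ 1 ]) n
      ≡⟨ cong (λ z → z · fallK c (z ⊖ K[ 1 ]) n) (K[]-homo-+ 1 s) ⟩
    (K[ 1 ] ⊕ K[ s ]) · fallK c (K[ 1 ] ⊕ K[ s ] ⊖ K[ 1 ]) n
      ≡⟨ cong (λ z → (K[ 1 ] ⊕ K[ s ]) · fallK c z n) (solve 1 (λ s → con (+ 1) :+ s :- con (+ 1) := s) refl K[ s ]) ⟩
    (K[ 1 ] ⊕ K[ s ]) · fallK c K[ s ] n
      ≡⟨ solve 3 (λ F s n → (con (+ 1) :+ s) :* F := F :* (s :- n) :+ (con (+ 1) :+ n) :* F)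
           refl (fallK c K[ s ] n) K[ s ] K[ n ] ⟩
    fallK c K[ s ] (suc n) ⊕ (K[ 1 ] ⊕ K[ n ]) · fallK c K[ s ] n
      ≡⟨ cong (λ z → fallK c K[ s ] (suc n) ⊕ z · fallK c K[ s ] n) (K[]-homo-+ 1 n) ⟨
    fallK c K[ s ] (suc n) ⊕ K[ suc n ] · fallK c K[ s ] n ∎

  fallK-split-reflect : ∀ k ℓ y →
    fallK c (y ⊕ K[ ℓ ]) (suc k ℕ.+ ℓ) ≡ fallK c (K[ ℓ ] ⊕ y) ℓ · (signK k · (y · fallK c (K[ k ] ⊖ y) k))
  fallK-split-reflect k ℓ y = begin
    fallK c (y ⊕ K[ ℓ ]) (suc k ℕ.+ ℓ)                  ≡⟨ cong (fallK c (y ⊕ K[ ℓ ])) (ℕP.+-comm (suc k) ℓ) ⟩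
    fallK c (y ⊕ K[ ℓ ]) (ℓ ℕ.+ suc k)                  ≡⟨ fallK-+ ℓ (suc k) (y ⊕ K[ ℓ ]) ⟩
    fallK c (y ⊕ K[ ℓ ]) ℓ · fallK c (y ⊕ K[ ℓ ] ⊖ K[ ℓ ]) (suc k)
      ≡⟨ cong₂ (λ u v → fallK c u ℓ · fallK c v (suc k))
               (solve 2 (λ y l → y :+ l := l :+ y) refl y K[ ℓ ]) (solve 2 (λ y l → y :+ l :- l := y) refl y K[ ℓ ]) ⟩
    fallK c (K[ ℓ ] ⊕ y) ℓ · fallK c y (suc k)          ≡⟨ cong (fallK c (K[ ℓ ] ⊕ y) ℓ ·_) (fallK-suc y k) ⟩
    fallK c (K[ ℓ ] ⊕ y) ℓ · (y · fallK c (y ⊖ K[ 1 ]) k)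
      ≡⟨ cong (λ z → fallK c (K[ ℓ ] ⊕ y) ℓ · (y · z)) (fallK-reflect k y) ⟨
    fallK c (K[ ℓ ] ⊕ y) ℓ · (y · (signK k · fallK c (K[ k ] ⊖ y) k))
      ≡⟨ cong (fallK c (K[ ℓ ] ⊕ y) ℓ ·_)
              (solve 3 (λ y σ F → y :* (σ :* F) := σ :* (y :* F)) refl y (signK k) (fallK c (K[ k ] ⊖ y) k)) ⟩
    fallK c (K[ ℓ ] ⊕ y) ℓ · (signK k · (y · fallK c (K[ k ] ⊖ y) k)) ∎

module Sums (c : ℕ) where
  open Ring c
  open FallingFactorials c
  open ≡-Reasoning

  sumK : (ℕ → K) → ℕ → K
  sumK f zero    = 0K
  sumK f (suc n) = sumK f n ⊕ f n

  sumK-cong : ∀ {f g} n → (∀ i → i < n → f i ≡ g i) → sumK f n ≡ sumK g n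
  sumK-cong zero    f≡g = refl
  sumK-cong (suc n) f≡g = cong₂ _⊕_ (sumK-cong n (λ i i<n → f≡g i (ℕP.m<n⇒m<1+n i<n))) (f≡g n ℕP.≤-refl)

  sumK-zero : ∀ {f} n → (∀ i → i < n → f i ≡ 0K) → sumK f n ≡ 0K
  sumK-zero n f≡0 = trans (sumK-cong n f≡0) (sumK-0K n)
    where
    sumK-0K : ∀ n → sumK (λ _ → 0K) n ≡ 0K
    sumK-0K zero    = refl
    sumK-0K (suc n) rewrite sumK-0K n = solve 0 (con (+ 0) :+ con (+ 0) := con (+ 0)) refl

  sumK-⊕ : ∀ f g n → sumK (λ i → f i ⊕ g i) n ≡ sumK f n ⊕ sumK g n
  sumK-⊕ f g zero    = solve 0 (con (+ 0) := con (+ 0) :+ con (+ 0)) refl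
  sumK-⊕ f g (suc n) rewrite sumK-⊕ f g n =
    solve 4 (λ a b u v → a :+ b :+ (u :+ v) := a :+ u :+ (b :+ v)) refl (sumK f n) (sumK g n) (f n) (g n)

  sumK-head : ∀ f n → sumK f (suc n) ≡ f 0 ⊕ sumK (λ i → f (suc i)) n
  sumK-head f zero    = solve 1 (λ a → con (+ 0) :+ a := a :+ con (+ 0)) refl (f 0)
  sumK-head f (suc n) = trans (cong (_⊕ f (suc n)) (sumK-head f n))
    (solve 3 (λ a b u → a :+ b :+ u := a :+ (b :+ u)) refl (f 0) (sumK (λ i → f (suc i)) n) (f (suc n)))

  ·-distribˡ-sumK : ∀ a f n → a · sumK f n ≡ sumK (λ i → a · f i) n
  ·-distribˡ-sumK a f zero    = solve 1 (λ a → a :* con (+ 0) := con (+ 0)) refl a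
  ·-distribˡ-sumK a f (suc n) rewrite sym (·-distribˡ-sumK a f n) =
    solve 3 (λ a b u → a :* (b :+ u) := a :* b :+ a :* u) refl a (sumK f n) (f n)

  -- Abel summation against the Pascal rule (s+1)^{\underline{i+1}} = s^{\underline{i+1}} + (i+1) s^{\underline i}.
  sumK-fallK-suc : ∀ (f : ℕ → K) s N → s < N →
    sumK (λ ℓ → fallK c K[ suc s ] ℓ · f ℓ) (suc N) ≡
    sumK (λ i → fallK c K[ s ] i · (f i ⊕ K[ suc i ] · f (suc i))) N
  sumK-fallK-suc f s N s<N = begin
    sumK F (suc N)                               ≡⟨ sumK-head F N ⟩
    F 0 ⊕ sumK (λ i → F (suc i)) N               ≡⟨ cong (F 0 ⊕_) (sumK-cong N (λ i _ → pascal i)) ⟩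
    G 0 ⊕ sumK (λ i → G (suc i) ⊕ H i) N         ≡⟨ cong (G 0 ⊕_) (sumK-⊕ (λ i → G (suc i)) H N) ⟩
    G 0 ⊕ (sumK (λ i → G (suc i)) N ⊕ sumK H N)
      ≡⟨ solve 3 (λ a b h → a :+ (b :+ h) := a :+ b :+ h) refl (G 0) (sumK (λ i → G (suc i)) N) (sumK H N) ⟩
    G 0 ⊕ sumK (λ i → G (suc i)) N ⊕ sumK H N    ≡⟨ cong (_⊕ sumK H N) (sumK-head G N) ⟨
    sumK G N ⊕ G N ⊕ sumK H N                    ≡⟨ cong (λ z → sumK G N ⊕ z ⊕ sumK H N) G-N≡0 ⟩
    sumK G N ⊕ 0K ⊕ sumK H N                     ≡⟨ solve 2 (λ g h → g :+ con (+ 0) :+ h := g :+ h) refl (sumK G N) (sumK H N) ⟩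
    sumK G N ⊕ sumK H N                          ≡⟨ sumK-⊕ G H N ⟨
    sumK (λ i → G i ⊕ H i) N                     ≡⟨ sumK-cong N (λ i _ → regroup i) ⟩
    sumK (λ i → fallK c K[ s ] i · (f i ⊕ K[ suc i ] · f (suc i))) N ∎
    where
    F G H : ℕ → K
    F ℓ = fallK c K[ suc s ] ℓ · f ℓ
    G ℓ = fallK c K[ s ] ℓ · f ℓ
    H i = K[ suc i ] · fallK c K[ s ] i · f (suc i)
    pascal : ∀ i → F (suc i) ≡ G (suc i) ⊕ H i
    pascal i = trans (cong (_· f (suc i)) (fallK-K[]-suc s i))
      (solve 4 (λ F i G a → (F :+ i :* G) :* a := F :* a :+ i :* G :* a)
        refl (fallK c K[ s ] (suc i)) K[ suc i ] (fallK c K[ s ] i) (f (suc i)))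
    regroup : ∀ i → G i ⊕ H i ≡ fallK c K[ s ] i · (f i ⊕ K[ suc i ] · f (suc i))
    regroup i = solve 4 (λ F i a b → F :* a :+ i :* F :* b := F :* (a :+ i :* b))
      refl (fallK c K[ s ] i) K[ suc i ] (f i) (f (suc i))
    G-N≡0 : G N ≡ 0K
    G-N≡0 = trans (cong (_· f N) (fallK-K[]-vanishes s N s<N))
      (solve 1 (λ a → con (+ 0) :* a := con (+ 0)) refl (f N))

[k+1]*[n+1]C[k+1]≡[n+1]*nCk : ∀ n k → suc k ℕ.* (suc n C suc k) ≡ suc n ℕ.* (n C k)
[k+1]*[n+1]C[k+1]≡[n+1]*nCk zero    zero    = refl
[k+1]*[n+1]C[k+1]≡[n+1]*nCk zero    (suc k) rewrite k>n⇒nCk≡0 {1} {suc (suc k)} (s≤s (s≤s z≤n))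
                                             | k>n⇒nCk≡0 {0} {suc k} (s≤s z≤n) = ℕP.*-zeroʳ (suc (suc k))
[k+1]*[n+1]C[k+1]≡[n+1]*nCk (suc n) zero    =
  trans (ℕP.*-identityˡ (suc (suc n) C 1)) (trans (nC1≡n (suc (suc n))) (sym (ℕP.*-identityʳ (suc (suc n)))))
[k+1]*[n+1]C[k+1]≡[n+1]*nCk (suc n) (suc k) = begin
  suc (suc k) ℕ.* (suc (suc n) C suc (suc k))
    ≡⟨ cong (suc (suc k) ℕ.*_) (nCk+nC[k+1]≡[n+1]C[k+1] (suc n) (suc k)) ⟨
  suc (suc k) ℕ.* (X ℕ.+ Y)
    ≡⟨ solve 3 (λ k X Y → (con 2 :+ k) :* (X :+ Y) := X :+ (con 1 :+ k) :* X :+ (con 2 :+ k) :* Y) refl k X Y ⟩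
  X ℕ.+ suc k ℕ.* X ℕ.+ suc (suc k) ℕ.* Y
    ≡⟨ cong₂ (λ u v → X ℕ.+ u ℕ.+ v)
             ([k+1]*[n+1]C[k+1]≡[n+1]*nCk n k) ([k+1]*[n+1]C[k+1]≡[n+1]*nCk n (suc k)) ⟩
  X ℕ.+ suc n ℕ.* (n C k) ℕ.+ suc n ℕ.* (n C suc k)
    ≡⟨ solve 4 (λ X n a b → X :+ (con 1 :+ n) :* a :+ (con 1 :+ n) :* b := X :+ (con 1 :+ n) :* (a :+ b))
         refl X n (n C k) (n C suc k) ⟩
  X ℕ.+ suc n ℕ.* (n C k ℕ.+ n C suc k)
    ≡⟨ cong (λ z → X ℕ.+ suc n ℕ.* z) (nCk+nC[k+1]≡[n+1]C[k+1] n k) ⟩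
  suc (suc n) ℕ.* X ∎
  where
  open ≡-Reasoning
  open Data.Nat.Solver.+-*-Solver
  X = suc n C suc k
  Y = suc n C suc (suc k)

module Newton (c : ℕ) (1≤c : 1 ≤ c) where
  open Ring c
  open Field c 1≤c
  open FallingFactorials c
  open Sums c
  open ≡-Reasoning

  -- The coefficients of 1 / (t + x)^{\underline{k+1}} in the basis x^{\underline ℓ}.
  newtonCoeff : ℕ → K → ℕ → K
  newtonCoeff k t ℓ = signK ℓ · K[ (k ℕ.+ ℓ) C ℓ ] · invK c (fallK c (t ⊕ K[ ℓ ]) (suc k ℕ.+ ℓ))

  -- With u = t + i + 1 and n = k + 1 + i, all three coefficients have denominator u^{\underline{n+1}},
  -- and the numerators match by absorption of binomial coefficients.
  newtonCoeff-shift : ∀ k t i → im t ≢ 0ℚ →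
    newtonCoeff k (t ⊕ K[ 1 ]) i ≡ newtonCoeff k t i ⊕ K[ suc i ] · newtonCoeff k t (suc i)
  newtonCoeff-shift k t i im≢0 = begin
    σ · b · invK c (fallK c (t ⊕ K[ 1 ] ⊕ K[ i ]) n)
      ≡⟨ cong (λ z → σ · b · invK c (fallK c z n)) t+1+i≡u ⟩
    σ · b · invK c (fallK c u n)                  ≡⟨ cong (σ · b ·_) 1/u^n ⟩
    σ · b · ((u ⊖ K[ n ]) · Z⁻¹)
      ≡⟨ solve 5 (λ σ b u n Z⁻¹ → σ :* b :* ((u :- n) :* Z⁻¹)
                                  := σ :* b :* (u :* Z⁻¹) :+ (:- σ) :* (n :* b) :* Z⁻¹)
           refl σ b u K[ n ] Z⁻¹ ⟩
    σ · b · (u · Z⁻¹) ⊕ ⊝ σ · (K[ n ] · b) · Z⁻¹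
      ≡⟨ cong₂ (λ x y → σ · b · x ⊕ ⊝ σ · y · Z⁻¹) (sym 1/[u-1]^n) absorption ⟩
    σ · b · invK c (fallK c (t ⊕ K[ i ]) n) ⊕ ⊝ σ · (K[ suc i ] · b′) · Z⁻¹
      ≡⟨ cong (σ · b · invK c (fallK c (t ⊕ K[ i ]) n) ⊕_)
              (solve 4 (λ σ i b′ Z⁻¹ → (:- σ) :* (i :* b′) :* Z⁻¹ := i :* ((:- σ) :* b′ :* Z⁻¹))
                 refl σ K[ suc i ] b′ Z⁻¹) ⟩
    σ · b · invK c (fallK c (t ⊕ K[ i ]) n) ⊕ K[ suc i ] · (⊝ σ · b′ · Z⁻¹)
      ≡⟨ cong (λ m → σ · b · invK c (fallK c (t ⊕ K[ i ]) n) ⊕ K[ suc i ] · (⊝ σ · b′ · invK c (fallK c u m)))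
              (ℕP.+-suc (suc k) i) ⟨
    σ · b · invK c (fallK c (t ⊕ K[ i ]) n) ⊕ K[ suc i ] · (⊝ σ · b′ · invK c (fallK c u (suc k ℕ.+ suc i))) ∎
    where
    σ  = signK i
    n  = suc k ℕ.+ i
    b  = K[ (k ℕ.+ i) C i ]
    b′ = K[ (k ℕ.+ suc i) C suc i ]
    u  = t ⊕ K[ suc i ]
    Z⁻¹ = invK c (fallK c u (suc n))
    Z≢0 : fallK c u (suc n) ≢ 0K
    Z≢0 = fallK-≢0 u (suc n) (λ im≡0 → im≢0 (trans (sym (im-⊕-K[] t (suc i))) im≡0))
    t+1+i≡u : t ⊕ K[ 1 ] ⊕ K[ i ] ≡ u
    t+1+i≡u = ⊕-K[]-+ t 1 i
    u-1≡t+i : u ⊖ K[ 1 ] ≡ t ⊕ K[ i ]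
    u-1≡t+i = trans (cong (λ z → t ⊕ z ⊖ K[ 1 ]) (K[]-homo-+ 1 i))
                    (solve 2 (λ t i → t :+ (con (+ 1) :+ i) :- con (+ 1) := t :+ i) refl t K[ i ])
    1/u^n : invK c (fallK c u n) ≡ (u ⊖ K[ n ]) · Z⁻¹
    1/u^n = invK-factor (fallK c u n) (u ⊖ K[ n ]) (fallK c u (suc n)) refl Z≢0
    1/[u-1]^n : invK c (fallK c (t ⊕ K[ i ]) n) ≡ u · Z⁻¹
    1/[u-1]^n = invK-factor (fallK c (t ⊕ K[ i ]) n) u (fallK c u (suc n))
      (trans (solve 2 (λ F u → F :* u := u :* F) refl (fallK c (t ⊕ K[ i ]) n) u)
             (trans (cong (λ z → u · fallK c z n) (sym u-1≡t+i)) (sym (fallK-suc u n))))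
      Z≢0
    absorption : K[ n ] · b ≡ K[ suc i ] · b′
    absorption = begin
      K[ n ] · b                                 ≡⟨ K[]-homo-* n ((k ℕ.+ i) C i) ⟨
      K[ suc (k ℕ.+ i) ℕ.* ((k ℕ.+ i) C i) ]     ≡⟨ cong K[_] ([k+1]*[n+1]C[k+1]≡[n+1]*nCk (k ℕ.+ i) i) ⟨
      K[ suc i ℕ.* (suc (k ℕ.+ i) C suc i) ]     ≡⟨ cong (λ m → K[ suc i ℕ.* (m C suc i) ]) (ℕP.+-suc k i) ⟨
      K[ suc i ℕ.* ((k ℕ.+ suc i) C suc i) ]     ≡⟨ K[]-homo-* (suc i) ((k ℕ.+ suc i) C suc i) ⟩
      K[ suc i ] · b′                            ∎

  newton-series : ∀ k s N t → s < N → im t ≢ 0ℚ →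
    sumK (λ ℓ → fallK c K[ s ] ℓ · newtonCoeff k t ℓ) N ≡ invK c (fallK c (t ⊕ K[ s ]) (suc k))
  newton-series k zero (suc N) t _ _ = begin
    sumK F (suc N)                      ≡⟨ sumK-head F N ⟩
    F 0 ⊕ sumK (λ i → F (suc i)) N      ≡⟨ cong (F 0 ⊕_) (sumK-zero N (λ i _ → F[1+i]≡0 i)) ⟩
    F 0 ⊕ 0K
      ≡⟨ cong (λ m → 1K · (1K · K[ m C 0 ] · invK c (fallK c (t ⊕ K[ 0 ]) (suc m))) ⊕ 0K) (ℕP.+-identityʳ k) ⟩
    1K · (1K · 1K · t⁻) ⊕ 0K
      ≡⟨ solve 1 (λ x → con (+ 1) :* (con (+ 1) :* con (+ 1) :* x) :+ con (+ 0) := x) refl t⁻ ⟩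
    t⁻                                  ∎
    where
    F : ℕ → K
    F ℓ = fallK c K[ 0 ] ℓ · newtonCoeff k t ℓ
    t⁻ = invK c (fallK c (t ⊕ K[ 0 ]) (suc k))
    F[1+i]≡0 : ∀ i → F (suc i) ≡ 0K
    F[1+i]≡0 i = trans (cong (_· newtonCoeff k t (suc i)) (fallK-K[]-vanishes 0 (suc i) (s≤s z≤n)))
                       (solve 1 (λ a → con (+ 0) :* a := con (+ 0)) refl (newtonCoeff k t (suc i)))
  newton-series k (suc s) (suc N) t (s≤s s<N) im≢0 = begin
    sumK (λ ℓ → fallK c K[ suc s ] ℓ · newtonCoeff k t ℓ) (suc N)
      ≡⟨ sumK-fallK-suc (newtonCoeff k t) s N s<N ⟩
    sumK (λ i → fallK c K[ s ] i · (newtonCoeff k t i ⊕ K[ suc i ] · newtonCoeff k t (suc i))) N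
      ≡⟨ sumK-cong {f = λ i → fallK c K[ s ] i · newtonCoeff k (t ⊕ K[ 1 ]) i} N
           (λ i _ → cong (fallK c K[ s ] i ·_) (newtonCoeff-shift k t i im≢0)) ⟨
    sumK (λ i → fallK c K[ s ] i · newtonCoeff k (t ⊕ K[ 1 ]) i) N
      ≡⟨ newton-series k s N (t ⊕ K[ 1 ]) s<N (λ im≡0 → im≢0 (trans (sym (im-⊕-K[] t 1)) im≡0)) ⟩
    invK c (fallK c (t ⊕ K[ 1 ] ⊕ K[ s ]) (suc k))
      ≡⟨ cong (λ z → invK c (fallK c z (suc k))) (⊕-K[]-+ t 1 s) ⟩
    invK c (fallK c (t ⊕ K[ suc s ]) (suc k)) ∎

-- conjK (pt⁺ s) and pt⁻ s are definitionally equal, which is used silently below.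
pt⁺ pt⁻ : ℕ → K
pt⁺ s = K[ s ] ⊕ ω
pt⁻ s = K[ s ] ⊖ ω

pt⁺-injective : ∀ {i j} → pt⁺ i ≡ pt⁺ j → i ≡ j
pt⁺-injective {i} {j} eq = ℚ[]-injective i j
  (trans (sym (ℚP.+-identityʳ ℚ[ i ])) (trans (cong re eq) (ℚP.+-identityʳ ℚ[ j ])))

pt⁺≢pt⁻ : ∀ i j → pt⁺ i ≢ pt⁻ j
pt⁺≢pt⁻ i j eq with () ← cong im eq

pt⁻-injective : ∀ {i j} → pt⁻ i ≡ pt⁻ j → i ≡ j
pt⁻-injective eq = pt⁺-injective (cong conjK eq)

module Formula (c : ℕ) where
  open Ring c
  open Polynomials c
  open Sums c
  open ≡-Reasoning

  evalP-Pk-pt⁻ : ∀ k s → s ≤ k → evalP (Pk c k) (pt⁻ s) ≡ 0K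
  evalP-Pk-pt⁻ zero    zero _     = trans (evalP-X+ ω (pt⁻ 0))
    (solve 1 (λ w → w :+ (con (+ 0) :- w) := con (+ 0)) refl ω)
  evalP-Pk-pt⁻ (suc k) s    s≤1+k with ℕP.m≤n⇒m<n∨m≡n s≤1+k
  ... | inj₁ (s≤s s≤k) = begin
    evalP (Pk c (suc k)) (pt⁻ s)                       ≡⟨ evalP-mulP-X+ (Pk c k) (ω ⊖ K[ suc k ]) (pt⁻ s) ⟩
    evalP (Pk c k) (pt⁻ s) · (ω ⊖ K[ suc k ] ⊕ pt⁻ s)  ≡⟨ cong (_· (ω ⊖ K[ suc k ] ⊕ pt⁻ s)) (evalP-Pk-pt⁻ k s s≤k) ⟩
    0K · (ω ⊖ K[ suc k ] ⊕ pt⁻ s)                      ≡⟨ solve 1 (λ y → con (+ 0) :* y := con (+ 0)) refl (ω ⊖ K[ suc k ] ⊕ pt⁻ s) ⟩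
    0K                                                 ∎
  ... | inj₂ refl = trans (evalP-mulP-X+ (Pk c k) (ω ⊖ K[ s ]) (pt⁻ s))
    (solve 3 (λ P w s → P :* ((w :- s) :+ (s :- w)) := con (+ 0)) refl (evalP (Pk c k) (pt⁻ s)) ω K[ s ])

  evalP-Pk-pt⁺ : ∀ k s → evalP (Pk c k) (pt⁺ s) ≡ fallK c (twoω ⊕ K[ s ]) (suc k)
  evalP-Pk-pt⁺ zero    s = trans (evalP-X+ ω (pt⁺ s))
    (solve 2 (λ w s → w :+ (s :+ w) := con (+ 1) :* ((w :+ w :+ s) :- con (+ 0))) refl ω K[ s ])
  evalP-Pk-pt⁺ (suc k) s = begin
    evalP (Pk c (suc k)) (pt⁺ s)                                 ≡⟨ evalP-mulP-X+ (Pk c k) (ω ⊖ K[ suc k ]) (pt⁺ s) ⟩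
    evalP (Pk c k) (pt⁺ s) · (ω ⊖ K[ suc k ] ⊕ pt⁺ s)            ≡⟨ cong (_· (ω ⊖ K[ suc k ] ⊕ pt⁺ s)) (evalP-Pk-pt⁺ k s) ⟩
    fallK c (twoω ⊕ K[ s ]) (suc k) · (ω ⊖ K[ suc k ] ⊕ pt⁺ s)
      ≡⟨ cong (fallK c (twoω ⊕ K[ s ]) (suc k) ·_)
              (solve 3 (λ w s k → (w :- k) :+ (s :+ w) := (w :+ w :+ s) :- k) refl ω K[ s ] K[ suc k ]) ⟩
    fallK c (twoω ⊕ K[ s ]) (suc k) · (twoω ⊕ K[ s ] ⊖ K[ suc k ]) ∎

  evalP-fallXω-pt⁺ : ∀ ℓ s → evalP (fallXω c ℓ) (pt⁺ s) ≡ fallK c K[ s ] ℓ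
  evalP-fallXω-pt⁺ zero    s = solve 1 (λ x → con (+ 1) :+ x :* con (+ 0) := con (+ 1)) refl (pt⁺ s)
  evalP-fallXω-pt⁺ (suc ℓ) s = begin
    evalP (fallXω c (suc ℓ)) (pt⁺ s)                      ≡⟨ evalP-mulP-X+ (fallXω c ℓ) (⊝ ω ⊖ K[ ℓ ]) (pt⁺ s) ⟩
    evalP (fallXω c ℓ) (pt⁺ s) · (⊝ ω ⊖ K[ ℓ ] ⊕ pt⁺ s)  ≡⟨ cong (_· (⊝ ω ⊖ K[ ℓ ] ⊕ pt⁺ s)) (evalP-fallXω-pt⁺ ℓ s) ⟩
    fallK c K[ s ] ℓ · (⊝ ω ⊖ K[ ℓ ] ⊕ pt⁺ s)
      ≡⟨ cong (fallK c K[ s ] ℓ ·_) (solve 3 (λ w s l → ((:- w) :- l) :+ (s :+ w) := s :- l) refl ω K[ s ] K[ ℓ ]) ⟩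
    fallK c K[ s ] ℓ · (K[ s ] ⊖ K[ ℓ ])                 ∎

  -- By definition sumTerm c k ℓ is scaleP c (alphaCoeff k ℓ) (fallXω c ℓ)
  -- and alphaFormula c k is scaleP c (invK c (alphaDenominator k)) (sumUpTo c k k).
  alphaCoeff : ℕ → ℕ → K
  alphaCoeff k ℓ = signK (k ℕ.+ ℓ) · K[ (k ℕ.+ ℓ) C ℓ ] · invK c (fallK c (K[ ℓ ] ⊕ twoω) ℓ)

  alphaDenominator : ℕ → K
  alphaDenominator k = twoω · fallK c (K[ k ] ⊖ twoω) k

  evalP-sumUpTo : ∀ k n x → evalP (sumUpTo c k n) x ≡ sumK (λ ℓ → evalP (sumTerm c k ℓ) x) (suc n)
  evalP-sumUpTo k zero    x = solve 1 (λ y → y := con (+ 0) :+ y) refl (evalP (sumTerm c k 0) x)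
  evalP-sumUpTo k (suc n) x = trans (evalP-⊕P (sumUpTo c k n) (sumTerm c k (suc n)) x)
    (cong (_⊕ evalP (sumTerm c k (suc n)) x) (evalP-sumUpTo k n x))

  DegLt-Pk : ∀ k → DegLt (Pk c k) (suc (suc k))
  DegLt-Pk zero    = DegLt-length (X+ ω)
  DegLt-Pk (suc k) = DegLt-mulP-X+ (Pk c k) (ω ⊖ K[ suc k ]) (DegLt-Pk k)

  DegLt-fallXω : ∀ ℓ → DegLt (fallXω c ℓ) (suc ℓ)
  DegLt-fallXω zero    = DegLt-length oneP
  DegLt-fallXω (suc ℓ) = DegLt-mulP-X+ (fallXω c ℓ) (⊝ ω ⊖ K[ ℓ ]) (DegLt-fallXω ℓ)

  DegLe-alphaFormula : ∀ k → DegLe (alphaFormula c k) k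
  DegLe-alphaFormula k = DegLt-scaleP (invK c (alphaDenominator k)) (sumUpTo c k k) (DegLt-sumUpTo ℕP.≤-refl)
    where
    DegLt-sumTerm : ∀ {ℓ} → ℓ ≤ k → DegLt (sumTerm c k ℓ) (suc k)
    DegLt-sumTerm {ℓ} ℓ≤k =
      DegLt-scaleP (alphaCoeff k ℓ) (fallXω c ℓ) (DegLt-weaken (fallXω c ℓ) (s≤s ℓ≤k) (DegLt-fallXω ℓ))
    DegLt-sumUpTo : ∀ {n} → n ≤ k → DegLt (sumUpTo c k n) (suc k)
    DegLt-sumUpTo {zero}  _   = DegLt-sumTerm z≤n
    DegLt-sumUpTo {suc n} n≤k = DegLt-⊕P (sumUpTo c k n) (sumTerm c k (suc n))
      (DegLt-sumUpTo (ℕP.≤-trans (ℕP.n≤1+n n) n≤k)) (DegLt-sumTerm n≤k)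

module FormulaAtNodes (c : ℕ) (1≤c : 1 ≤ c) where
  open Ring c
  open Field c 1≤c
  open Polynomials c
  open FallingFactorials c
  open Sums c
  open Newton c 1≤c
  open Formula c
  open ≡-Reasoning

  alphaDenominator≢0 : ∀ k → alphaDenominator k ≢ 0K
  alphaDenominator≢0 k = x≢0⇒y≢0⇒x·y≢0 twoω (fallK c (K[ k ] ⊖ twoω) k) (im≢0⇒≢0K twoω (λ ()))
    (fallK-≢0 (K[ k ] ⊖ twoω) k (λ ()))

  newtonCoeff-2ω : ∀ k ℓ → newtonCoeff k twoω ℓ ≡ invK c (alphaDenominator k) · alphaCoeff k ℓ
  newtonCoeff-2ω k ℓ = begin
    σℓ · b · invK c (fallK c (twoω ⊕ K[ ℓ ]) (suc k ℕ.+ ℓ))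
      ≡⟨ cong (λ z → σℓ · b · invK c z) (fallK-split-reflect k ℓ twoω) ⟩
    σℓ · b · invK c (A · (σk · B))   ≡⟨ cong (σℓ · b ·_) 1/A·σk·B ⟩
    σℓ · b · (A⁻¹ · (σk · B⁻¹))
      ≡⟨ solve 5 (λ σℓ b A⁻¹ σk B⁻¹ → σℓ :* b :* (A⁻¹ :* (σk :* B⁻¹)) := B⁻¹ :* (σk :* σℓ :* b :* A⁻¹))
           refl σℓ b A⁻¹ σk B⁻¹ ⟩
    B⁻¹ · (σk · σℓ · b · A⁻¹)        ≡⟨ cong (λ σ → B⁻¹ · (σ · b · A⁻¹)) (signK-+ k ℓ) ⟨
    B⁻¹ · alphaCoeff k ℓ             ∎
    where
    σℓ = signK ℓ
    σk = signK k
    b  = K[ (k ℕ.+ ℓ) C ℓ ]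
    A  = fallK c (K[ ℓ ] ⊕ twoω) ℓ
    A⁻¹ = invK c A
    B  = alphaDenominator k
    B⁻¹ = invK c B
    1/A·σk·B : invK c (A · (σk · B)) ≡ A⁻¹ · (σk · B⁻¹)
    1/A·σk·B = invK-unique (A · (σk · B)) (A⁻¹ · (σk · B⁻¹)) (begin
      A · (σk · B) · (A⁻¹ · (σk · B⁻¹))
        ≡⟨ solve 5 (λ A σk B A⁻¹ B⁻¹ → A :* (σk :* B) :* (A⁻¹ :* (σk :* B⁻¹))
                                      := A :* A⁻¹ :* (σk :* σk) :* (B :* B⁻¹))
             refl A σk B A⁻¹ B⁻¹ ⟩
      A · A⁻¹ · (σk · σk) · (B · B⁻¹)
        ≡⟨ cong₂ (λ x y → x · (σk · σk) · y)
                 (·-inverseʳ A (fallK-≢0 (K[ ℓ ] ⊕ twoω) ℓ (λ ()))) (·-inverseʳ B (alphaDenominator≢0 k)) ⟩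
      1K · (σk · σk) · 1K   ≡⟨ cong (λ x → 1K · x · 1K) (signK-·-signK k) ⟩
      1K · 1K · 1K          ≡⟨ solve 0 (con (+ 1) :* con (+ 1) :* con (+ 1) := con (+ 1)) refl ⟩
      1K                    ∎)

  evalP-alphaFormula-pt⁺ : ∀ k s → s ≤ k →
    evalP (alphaFormula c k) (pt⁺ s) ≡ invK c (fallK c (twoω ⊕ K[ s ]) (suc k))
  evalP-alphaFormula-pt⁺ k s s≤k = begin
    evalP (alphaFormula c k) (pt⁺ s)                             ≡⟨ evalP-scaleP B⁻¹ (sumUpTo c k k) (pt⁺ s) ⟩
    B⁻¹ · evalP (sumUpTo c k k) (pt⁺ s)                          ≡⟨ cong (B⁻¹ ·_) (evalP-sumUpTo k k (pt⁺ s)) ⟩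
    B⁻¹ · sumK (λ ℓ → evalP (sumTerm c k ℓ) (pt⁺ s)) (suc k)      ≡⟨ ·-distribˡ-sumK B⁻¹ (λ ℓ → evalP (sumTerm c k ℓ) (pt⁺ s)) (suc k) ⟩
    sumK (λ ℓ → B⁻¹ · evalP (sumTerm c k ℓ) (pt⁺ s)) (suc k)      ≡⟨ sumK-cong (suc k) (λ ℓ _ → term ℓ) ⟩
    sumK (λ ℓ → fallK c K[ s ] ℓ · newtonCoeff k twoω ℓ) (suc k)  ≡⟨ newton-series k s (suc k) twoω (s≤s s≤k) (λ ()) ⟩
    invK c (fallK c (twoω ⊕ K[ s ]) (suc k))                     ∎
    where
    B⁻¹ = invK c (alphaDenominator k)
    term : ∀ ℓ → B⁻¹ · evalP (sumTerm c k ℓ) (pt⁺ s) ≡ fallK c K[ s ] ℓ · newtonCoeff k twoω ℓ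
    term ℓ = begin
      B⁻¹ · evalP (sumTerm c k ℓ) (pt⁺ s)          ≡⟨ cong (B⁻¹ ·_) (evalP-scaleP (alphaCoeff k ℓ) (fallXω c ℓ) (pt⁺ s)) ⟩
      B⁻¹ · (alphaCoeff k ℓ · evalP (fallXω c ℓ) (pt⁺ s)) ≡⟨ cong (λ z → B⁻¹ · (alphaCoeff k ℓ · z)) (evalP-fallXω-pt⁺ ℓ s) ⟩
      B⁻¹ · (alphaCoeff k ℓ · fallK c K[ s ] ℓ)
        ≡⟨ solve 3 (λ x a f → x :* (a :* f) := f :* (x :* a)) refl B⁻¹ (alphaCoeff k ℓ) (fallK c K[ s ] ℓ) ⟩
      fallK c K[ s ] ℓ · (B⁻¹ · alphaCoeff k ℓ)    ≡⟨ cong (fallK c K[ s ] ℓ ·_) (newtonCoeff-2ω k ℓ) ⟨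
      fallK c K[ s ] ℓ · newtonCoeff k twoω ℓ       ∎

module Bezout (c : ℕ) (1≤c : 1 ≤ c) (k : ℕ) where
  open Ring c
  open Field c 1≤c
  open Polynomials c
  open Roots c 1≤c
  open Formula c
  open FormulaAtNodes c 1≤c
  open ≡-Reasoning

  private
    P = Pk c k

  bezoutP : Poly → Poly
  bezoutP α = mulP c α P ⊕P mulP c (conjP α) (conjP P)

  Interpolates : Poly → Set
  Interpolates α = ∀ s → s ≤ k → evalP α (pt⁺ s) · evalP P (pt⁺ s) ≡ 1K

  nodes⁺ nodes⁻ : List K
  nodes⁺ = applyUpTo pt⁺ (suc k)
  nodes⁻ = applyUpTo pt⁻ (suc k)

  evalP-bezoutP : ∀ α x →
    evalP (bezoutP α) x ≡ evalP α x · evalP P x ⊕ conjK (evalP α (conjK x) · evalP P (conjK x))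
  evalP-bezoutP α x = begin
    evalP (bezoutP α) x
      ≡⟨ evalP-⊕P (mulP c α P) (mulP c (conjP α) (conjP P)) x ⟩
    evalP (mulP c α P) x ⊕ evalP (mulP c (conjP α) (conjP P)) x
      ≡⟨ cong₂ _⊕_ (evalP-mulP α P x) (evalP-mulP (conjP α) (conjP P) x) ⟩
    evalP α x · evalP P x ⊕ evalP (conjP α) x · evalP (conjP P) x
      ≡⟨ cong₂ (λ u v → evalP α x · evalP P x ⊕ u · v) (evalP-conjP α x) (evalP-conjP P x) ⟩
    evalP α x · evalP P x ⊕ conjK (evalP α (conjK x)) · conjK (evalP P (conjK x))
      ≡⟨ cong (evalP α x · evalP P x ⊕_) (conjK-homo-· (evalP α (conjK x)) (evalP P (conjK x))) ⟨
    evalP α x · evalP P x ⊕ conjK (evalP α (conjK x) · evalP P (conjK x)) ∎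

  evalP-bezoutP-pt⁺ : ∀ α s → s ≤ k → evalP (bezoutP α) (pt⁺ s) ≡ evalP α (pt⁺ s) · evalP P (pt⁺ s)
  evalP-bezoutP-pt⁺ α s s≤k = begin
    evalP (bezoutP α) (pt⁺ s)                         ≡⟨ evalP-bezoutP α (pt⁺ s) ⟩
    v ⊕ conjK (evalP α (pt⁻ s) · evalP P (pt⁻ s))     ≡⟨ cong (λ z → v ⊕ conjK (evalP α (pt⁻ s) · z)) (evalP-Pk-pt⁻ k s s≤k) ⟩
    v ⊕ conjK (evalP α (pt⁻ s) · 0K)
      ≡⟨ cong (λ z → v ⊕ conjK z) (solve 1 (λ a → a :* con (+ 0) := con (+ 0)) refl (evalP α (pt⁻ s))) ⟩
    v ⊕ 0K                                            ≡⟨ solve 1 (λ v → v :+ con (+ 0) := v) refl v ⟩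
    v                                                 ∎
    where v = evalP α (pt⁺ s) · evalP P (pt⁺ s)

  evalP-bezoutP-pt⁻ : ∀ α s → s ≤ k → evalP (bezoutP α) (pt⁻ s) ≡ conjK (evalP α (pt⁺ s) · evalP P (pt⁺ s))
  evalP-bezoutP-pt⁻ α s s≤k = begin
    evalP (bezoutP α) (pt⁻ s)                         ≡⟨ evalP-bezoutP α (pt⁻ s) ⟩
    evalP α (pt⁻ s) · evalP P (pt⁻ s) ⊕ conjK v       ≡⟨ cong (λ z → evalP α (pt⁻ s) · z ⊕ conjK v) (evalP-Pk-pt⁻ k s s≤k) ⟩
    evalP α (pt⁻ s) · 0K ⊕ conjK v                    ≡⟨ solve 2 (λ a w → a :* con (+ 0) :+ w := w) refl (evalP α (pt⁻ s)) (conjK v) ⟩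
    conjK v                                           ∎
    where v = evalP α (pt⁺ s) · evalP P (pt⁺ s)

  solvesBezout⇒interpolates : ∀ α → SolvesBezout c k α → Interpolates α
  solvesBezout⇒interpolates α bezout s s≤k = begin
    evalP α (pt⁺ s) · evalP P (pt⁺ s)   ≡⟨ evalP-bezoutP-pt⁺ α s s≤k ⟨
    evalP (bezoutP α) (pt⁺ s)           ≡⟨ evalP-≈P (bezoutP α) oneP (pt⁺ s) bezout ⟩
    evalP oneP (pt⁺ s)                  ≡⟨ solve 1 (λ x → con (+ 1) :+ x :* con (+ 0) := con (+ 1)) refl (pt⁺ s) ⟩
    1K                                  ∎

  private
    unique-nodes⁺ : Unique nodes⁺
    unique-nodes⁺ = UniqueP.applyUpTo⁺₁ pt⁺ (suc k) (λ i<j _ eq → ℕP.<⇒≢ i<j (pt⁺-injective eq))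

    unique-nodes⁻ : Unique nodes⁻
    unique-nodes⁻ = UniqueP.applyUpTo⁺₁ pt⁻ (suc k) (λ i<j _ eq → ℕP.<⇒≢ i<j (pt⁻-injective eq))

    disjoint-nodes : Disjoint nodes⁺ nodes⁻
    disjoint-nodes (v∈⁺ , v∈⁻) with ∈-applyUpTo⁻ pt⁺ v∈⁺ | ∈-applyUpTo⁻ pt⁻ v∈⁻
    ... | i , _ , v≡i⁺ | j , _ , v≡j⁻ = pt⁺≢pt⁻ i j (trans (sym v≡i⁺) v≡j⁻)

    length-nodes : length (nodes⁺ ++ nodes⁻) ≡ suc k ℕ.+ suc k
    length-nodes = trans (length-++ nodes⁺)
      (cong₂ ℕ._+_ (length-applyUpTo pt⁺ (suc k)) (length-applyUpTo pt⁻ (suc k)))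

  interpolates⇒solvesBezout : ∀ α → DegLe α k → Interpolates α → SolvesBezout c k α
  interpolates⇒solvesBezout α degα interp = agree⇒≈P (bezoutP α) oneP (nodes⁺ ++ nodes⁻)
    (UniqueP.++⁺ unique-nodes⁺ unique-nodes⁻ disjoint-nodes)
    (AllP.++⁺ (AllP.applyUpTo⁺₁ pt⁺ (suc k) agree⁺) (AllP.applyUpTo⁺₁ pt⁻ (suc k) agree⁻))
    (subst (DegLt (bezoutP α)) (sym length-nodes) degR)
    (subst (DegLt oneP) (sym length-nodes) (DegLt-weaken oneP (s≤s z≤n) (DegLt-length oneP)))
    where
    one : ∀ x → 1K ≡ evalP oneP x
    one x = solve 1 (λ x → con (+ 1) := con (+ 1) :+ x :* con (+ 0)) refl x
    agree⁺ : ∀ {s} → s < suc k → evalP (bezoutP α) (pt⁺ s) ≡ evalP oneP (pt⁺ s)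
    agree⁺ {s} (s≤s s≤k) = trans (evalP-bezoutP-pt⁺ α s s≤k) (trans (interp s s≤k) (one (pt⁺ s)))
    agree⁻ : ∀ {s} → s < suc k → evalP (bezoutP α) (pt⁻ s) ≡ evalP oneP (pt⁻ s)
    agree⁻ {s} (s≤s s≤k) = trans (evalP-bezoutP-pt⁻ α s s≤k) (trans (cong conjK (interp s s≤k)) (one (pt⁻ s)))
    degR : DegLt (bezoutP α) (suc k ℕ.+ suc k)
    degR = DegLt-⊕P (mulP c α P) (mulP c (conjP α) (conjP P))
      (DegLt-mulP α P degα (DegLt-Pk k))
      (DegLt-mulP (conjP α) (conjP P) (DegLt-conjP α degα) (DegLt-conjP P (DegLt-Pk k)))

  interpolates-unique : ∀ α β → DegLe α k → DegLe β k → Interpolates α → Interpolates β → α ≈P β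
  interpolates-unique α β degα degβ interpα interpβ = agree⇒≈P α β nodes⁺ unique-nodes⁺
    (AllP.applyUpTo⁺₁ pt⁺ (suc k) (λ { (s≤s s≤k) → cancel (interpα _ s≤k) (interpβ _ s≤k) }))
    (subst (DegLt α) (sym (length-applyUpTo pt⁺ (suc k))) degα)
    (subst (DegLt β) (sym (length-applyUpTo pt⁺ (suc k))) degβ)
    where
    cancel : ∀ {a b p} → a · p ≡ 1K → b · p ≡ 1K → a ≡ b
    cancel {a} {b} {p} ap≡1 bp≡1 = begin
      a             ≡⟨ solve 1 (λ a → a := a :* con (+ 1)) refl a ⟩
      a · 1K        ≡⟨ cong (a ·_) bp≡1 ⟨
      a · (b · p)   ≡⟨ solve 3 (λ a b p → a :* (b :* p) := a :* p :* b) refl a b p ⟩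
      a · p · b     ≡⟨ cong (_· b) ap≡1 ⟩
      1K · b        ≡⟨ solve 1 (λ b → con (+ 1) :* b := b) refl b ⟩
      b             ∎

  alphaFormula-interpolates : Interpolates (alphaFormula c k)
  alphaFormula-interpolates s s≤k = begin
    evalP (alphaFormula c k) (pt⁺ s) · evalP P (pt⁺ s)
      ≡⟨ cong₂ _·_ (evalP-alphaFormula-pt⁺ k s s≤k) (evalP-Pk-pt⁺ k s) ⟩
    invK c (fallK c (twoω ⊕ K[ s ]) (suc k)) · fallK c (twoω ⊕ K[ s ]) (suc k)
      ≡⟨ ·-inverseˡ (fallK c (twoω ⊕ K[ s ]) (suc k)) (fallK-≢0 (twoω ⊕ K[ s ]) (suc k) (λ ())) ⟩
    1K ∎

corollary3 : (c : ℕ) → 1 ≤ c → (k : ℕ) →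
    DegLe (alphaFormula c k) k × SolvesBezout c k (alphaFormula c k)
    × ((α : Poly) → DegLe α k → SolvesBezout c k α → α ≈P alphaFormula c k)
corollary3 c 1≤c k =
    DegLe-alphaFormula k
  , interpolates⇒solvesBezout (alphaFormula c k) (DegLe-alphaFormula k) alphaFormula-interpolates
  , λ α degα bezout → interpolates-unique α (alphaFormula c k) degα (DegLe-alphaFormula k)
                        (solvesBezout⇒interpolates α bezout) alphaFormula-interpolates
  where
  open Formula c
  open Bezout c 1≤c k
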